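{- Let $p\geq 2$ and $k>6p$, let $L_1,\dots,L_{p+1}\subseteq V(C_k^p)$ be incomparable sets, let $L\subseteq V(C_k^p)$, and let $S\in F=L_1\times\dots\times L_{p+1}$ be minimal with no common neighbor in $L$. Then $S$ can be forbidden by a polynomial of degree at most $p$ with respect to $(F,L)$.
   Context: $C_k^p$ is the graph on $\{0,\dots,k-1\}$ in which distinct $u,v$ are adjacent iff $\min\{|u-v|,k-|u-v|\}\le p$ (no loops). $N(v)$ is the neighborhood of $v$; vertices $u,v$ are incomparable if neither $N(u)\subseteq N(v)$ nor $N(v)\subseteq N(u)$; a set is incomparable if its vertices are pairwise incomparable. A tuple has a common neighbor in $L$ if some vertex of $L$ is adjacent to all its entries; "minimal" means no proper subset of its entries lacks a common neighbor in $L$. Polynomial forbidding (with $H=C_k^p$): for a finite set $X$, Boolean variables $y_{v,u}$ ($v\in X,u\in V(H)$) form $\mathbf{y}$; a choice assignment satisfies $\sum_u y_{v,u}=1$ for all $v\in X$. $S=(s_1,\dots,s_r)\in F$ can be forbidden (on distinct $v_1,\dots,v_r\in X$) by a polynomial of degree $d$ with respect to $(F,L)$ if there is a polynomial $q$ over GF(2) of degree at most $d$ in $\mathbf{y}$ such that for every choice assignment, letting $s_\ell'$ be the unique vertex with $y_{v_\ell,s_\ell'}=1$ and $S'=(s_1',\dots,s_r')$: if $S'=S$ then $q(\mathbf{y})\ne0$, and if $S'$ has a common neighbor in $L$ then $q(\mathbf{y})=0$. The claim is for arbitrary finite $X$ and distinct $v_1,\dots,v_{p+1}\in X$. -}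

module Defs where

open import Data.Nat using (ℕ; suc; _≤_; _⊓_; _∸_; ∣_-_∣)
open import Data.Fin using (Fin; toℕ)
open import Data.Fin.Subset using (Subset; _∈_; _∉_)
open import Data.Bool using (Bool; true; false; _∧_; _xor_)
open import Data.List using (List; []; _∷_; length)
open import Data.List.Relation.Unary.All using (All)
open import Data.Product using (Σ; ∃; _×_; _,_)
open import Relation.Binary.PropositionalEquality using (_≡_; _≢_)
open import Relation.Nullary using (¬_)

Adj : (k p : ℕ) → Fin k → Fin k → Set
Adj k p u v = u ≢ v × (∣ toℕ u - toℕ v ∣ ⊓ (k ∸ ∣ toℕ u - toℕ v ∣)) ≤ p

NbhdSub : (k p : ℕ) → Fin k → Fin k → Set
NbhdSub k p u v = ∀ w → Adj k p u w → Adj k p v w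

Incomparable : (k p : ℕ) → Fin k → Fin k → Set
Incomparable k p u v = ¬ NbhdSub k p u v × ¬ NbhdSub k p v u

IncomparableSet : (k p : ℕ) → Subset k → Set
IncomparableSet k p A = ∀ u v → u ∈ A → v ∈ A → u ≢ v → Incomparable k p u v

HasCommonNbr : (k p : ℕ) {r : ℕ} → Subset k → (Fin r → Fin k) → Set
HasCommonNbr k p L T = ∃ λ w → w ∈ L × (∀ i → Adj k p w (T i))

HasCommonNbrOn : (k p : ℕ) {r : ℕ} → Subset k → (Fin r → Fin k) → Subset r → Set
HasCommonNbrOn k p L T I = ∃ λ w → w ∈ L × (∀ i → i ∈ I → Adj k p w (T i))

MinimalNoCommonNbr : (k p : ℕ) {r : ℕ} → Subset k → (Fin r → Fin k) → Set
MinimalNoCommonNbr k p {r} L S =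
  ¬ HasCommonNbr k p L S ×
  (∀ (I : Subset r) → (∃ λ i → i ∉ I) → HasCommonNbrOn k p L S I)

-- Polynomials over GF(2) in the Boolean variables y_{v,u}, v ∈ X = Fin n, u ∈ Fin k.
-- A polynomial is a GF(2)-sum of monomials; a monomial is a product of variables.
Var : ℕ → ℕ → Set
Var n k = Fin n × Fin k

Monomial : ℕ → ℕ → Set
Monomial n k = List (Var n k)

Poly : ℕ → ℕ → Set
Poly n k = List (Monomial n k)

DegreeLE : {n k : ℕ} → Poly n k → ℕ → Set
DegreeLE q d = All (λ m → length m ≤ d) q

evalMon : {n k : ℕ} → (Fin n → Fin k → Bool) → Monomial n k → Bool
evalMon y [] = true
evalMon y ((v , u) ∷ m) = y v u ∧ evalMon y m

evalPoly : {n k : ℕ} → (Fin n → Fin k → Bool) → Poly n k → Bool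
evalPoly y [] = false
evalPoly y (m ∷ q) = evalMon y m xor evalPoly y q

ChoiceAssignment : {n k : ℕ} → (Fin n → Fin k → Bool) → Set
ChoiceAssignment {n} {k} y =
  ∀ (v : Fin n) → ∃ λ (u : Fin k) → (y v u ≡ true) × (∀ u′ → y v u′ ≡ true → u′ ≡ u)

-- S can be forbidden on (v_1..v_r) by a polynomial of degree ≤ d w.r.t. (F, L).
-- S′ below is the tuple selected by y on v_1..v_r (y_{v_ℓ, S′_ℓ} = 1 determines it uniquely).
ForbiddableOn : (k p : ℕ) {n r : ℕ} → Subset k → (Fin r → Fin k) →
                (Fin r → Fin n) → ℕ → Set
ForbiddableOn k p {n} {r} L S vs d =
  Σ (Poly n k) λ q → DegreeLE q d ×
    (∀ (y : Fin n → Fin k → Bool) → ChoiceAssignment y →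
     ∀ (S′ : Fin r → Fin k) → (∀ ℓ → y (vs ℓ) (S′ ℓ) ≡ true) →
       ((∀ ℓ → S′ ℓ ≡ S ℓ) → evalPoly y q ≡ true) ×
       (HasCommonNbr k p L S′ → evalPoly y q ≡ false))

-- Write p = 2 + q. For a tuple x of vertices and c ∈ ℤ_k, let T(x, c) hold when each of
-- c, c + 1, …, c + q is occupied by an odd number of entries of x and an odd number of entries
-- lie at distance 2, …, p + 2 before c. The polynomial
--   ∑_c ∏_{i ≤ q} (∑_j y_{v_j, c+i}) · ∑_j ∑_{2 ≤ d ≤ p+2} y_{v_j, c−d}
-- has degree p and evaluates to ∑_c T(x, c) at the choice assignment selecting x.
-- If x has a common neighbour w, every entry lies within distance p of w, so T(x, c) can only
-- hold for c = w + 1 or c = w + 2, and the parity of the number of entries on either side of w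
-- makes these two values equal: the sum vanishes. If S is minimal, the common neighbours of all
-- entries but one force the positions of S to be {a, …, a + p} or {a} ∪ {a + 2, …, a + p} ∪
-- {a + p + 2}, and T(S, c) holds for c = a + 2 only. As k > 6p, all relevant vertices lie on an
-- arc of the cycle, which is treated as an interval of ℕ.

module Submission where

open import Algebra.Bundles using (CommutativeRing)
open import Data.Bool using (Bool; true; false; _∧_; _xor_; if_then_else_)
open import Data.Bool.Properties
  using (xor-∧-commutativeRing; xor-same; xor-identityʳ; xor-assoc; ∧-assoc; ∧-zeroʳ; ∧-identityʳ;
         ∧-distribˡ-xor; ∧-distribʳ-xor; not-injective; not-distribʳ-xor; ¬-not)
open import Data.Empty using (⊥; ⊥-elim)
import Data.Fin as Fin
open import Data.Fin using (Fin; zero; suc; toℕ; fromℕ; fromℕ<; inject₁; punchIn; punchOut)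
open import Data.Fin.Properties
  using (any?; injective⇒≤; punchIn-injective; punchInᵢ≢i; punchIn-punchOut; punchOut-injective;
         toℕ<n; toℕ≤pred[n]; toℕ-injective; toℕ-fromℕ<; toℕ-inject₁)
open import Data.Fin.Subset using (Subset; _∈_; ∁; ⁅_⁆)
open import Data.Fin.Subset.Properties using (x∈p⇒x∉∁p; x∈⁅x⁆; x∉p⇒x∈∁p; x≢y⇒x∉⁅y⁆)
open import Data.List using (List; []; _∷_; _++_; map; length; [_]; applyUpTo)
open import Data.List.Membership.Propositional using () renaming (_∈_ to _∈ₗ_)
open import Data.List.Membership.Propositional.Properties using (∈-applyUpTo⁺)
open import Data.List.Membership.Setoid.Properties using (index-injective)
open import Data.List.Properties using (length-++; length-applyUpTo)
open import Data.List.Relation.Unary.All using ([]; _∷_)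
open import Data.List.Relation.Unary.All.Properties using (++⁺)
open import Data.List.Relation.Unary.Any using (index; here; there)
open import Data.Nat
  using (ℕ; zero; suc; _+_; _*_; _∸_; _≤_; _<_; z≤n; s≤s; _≟_; _≤?_; _<?_; _⊓_; ∣_-_∣;
         NonZero; >-nonZero; >-nonZero⁻¹)
open import Data.Nat.DivMod
  using (_%_; m%n<n; %-distribˡ-+; m%n%n≡m%n; [m+n]%n≡m%n; m<n⇒m%n≡m; m≤n⇒[n∸m]%m≡n%m)
open import Data.Nat.Properties
open import Data.Nat.Tactic.RingSolver using (solve-∀)
open import Data.Product using (∃; _×_; _,_; proj₁; proj₂; uncurry)
open import Data.Sum using (_⊎_; inj₁; inj₂; [_,_]′)
open import Defs
open import Function using (_∘_; _⇔_; mk⇔; Equivalence)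
open import Function.Definitions using (Injective)
open import Relation.Binary.Definitions using (tri<; tri≈; tri>)
open import Relation.Binary.PropositionalEquality
  using (_≡_; _≢_; refl; sym; trans; cong; cong₂; subst; subst₂; setoid; module ≡-Reasoning)
open import Relation.Nullary using (Dec; yes; no; does; ¬_; contradiction)
open import Relation.Nullary.Decidable using (dec-true; dec-false; does-⇔)

open Equivalence using (to; from)
open CommutativeRing xor-∧-commutativeRing using (+-commutativeMonoid; +-monoid; *-monoid)
open import Algebra.Properties.CommutativeMonoid.Sum +-commutativeMonoid
  using (sum-syntax; sum-cong-≗; sum-remove; sum-replicate; sum-init-last; ∑-comm; ∑-distrib-+)
open import Algebra.Properties.Monoid.Mult +-monoid using (×-homo-+) renaming (_×_ to _·_)
open import Algebra.Properties.Monoid.Sum *-monoid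
  using () renaming (sum to ⋀; sum-cong-≗ to ⋀-cong; sum-init-last to ⋀-init-last)

-- Parity sums over Fin

does≡true⇒ : ∀ {a} {A : Set a} (a? : Dec A) → does a? ≡ true → A
does≡true⇒ (yes a) _ = a

∧≡true⇒ : ∀ {a b} → a ∧ b ≡ true → a ≡ true × b ≡ true
∧≡true⇒ {true} {true} _ = refl , refl

∑-false : ∀ {n} (f : Fin n → Bool) → (∀ i → f i ≡ false) → ∑[ i < n ] f i ≡ false
∑-false {zero}  f f≡false = refl
∑-false {suc n} f f≡false = cong₂ _xor_ (f≡false zero) (∑-false (f ∘ suc) (f≡false ∘ suc))

∑-single : ∀ {n} (f : Fin n → Bool) i → (∀ j → j ≢ i → f j ≡ false) → ∑[ j < n ] f j ≡ f i
∑-single {suc n} f i others = begin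
  ∑[ j < suc n ] f j                      ≡⟨ sum-remove f ⟩
  f i xor ∑[ j < n ] f (punchIn i j)      ≡⟨ cong (f i xor_) (∑-false _ (λ j → others _ (punchInᵢ≢i i j))) ⟩
  f i xor false                           ≡⟨ xor-identityʳ (f i) ⟩
  f i                                     ∎
  where open ≡-Reasoning

∑-pair : ∀ {n} (f : Fin n → Bool) {i i′} → i ≢ i′ →
         (∀ j → j ≢ i → j ≢ i′ → f j ≡ false) → ∑[ j < n ] f j ≡ f i xor f i′
∑-pair {suc n} f {i} {i′} i≢i′ others = begin
  ∑[ j < suc n ] f j                   ≡⟨ sum-remove f ⟩
  f i xor ∑[ j < n ] f (punchIn i j)   ≡⟨ cong (f i xor_) (∑-single _ (punchOut i≢i′) rest) ⟩
  f i xor f (punchIn i (punchOut i≢i′)) ≡⟨ cong (λ j → f i xor f j) (punchIn-punchOut i≢i′) ⟩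
  f i xor f i′                         ∎
  where
  open ≡-Reasoning
  rest : ∀ j → j ≢ punchOut i≢i′ → f (punchIn i j) ≡ false
  rest j j≢ = others _ (punchInᵢ≢i i j)
    (λ eq → j≢ (punchIn-injective i _ _ (trans eq (sym (punchIn-punchOut i≢i′)))))

∑≡true⇒∃ : ∀ {n} (f : Fin n → Bool) → ∑[ j < n ] f j ≡ true → ∃ λ i → f i ≡ true
∑≡true⇒∃ {suc n} f ∑≡true with f zero in f₀
... | true  = zero , f₀
... | false with i , fᵢ ← ∑≡true⇒∃ (f ∘ suc) ∑≡true = suc i , fᵢ

∑-true : ∀ {n} (f : Fin n → Bool) → (∀ i → f i ≡ true) → ∑[ j < n ] f j ≡ n · true
∑-true {n} f f≡true = trans (sum-cong-≗ f≡true) (sum-replicate n)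

⋀≡true⇒ : ∀ {n} (f : Fin n → Bool) → ⋀ f ≡ true → ∀ i → f i ≡ true
⋀≡true⇒ f ⋀≡true zero with f zero
... | true = refl
⋀≡true⇒ f ⋀≡true (suc i) with f zero
... | true = ⋀≡true⇒ (f ∘ suc) ⋀≡true i

⋀-true : ∀ {n} (f : Fin n → Bool) → (∀ i → f i ≡ true) → ⋀ f ≡ true
⋀-true {zero}  f f≡true = refl
⋀-true {suc n} f f≡true = cong₂ _∧_ (f≡true zero) (⋀-true (f ∘ suc) (f≡true ∘ suc))

-- If the inner entries are all true they contribute q to the parity, so n ≡ not (a₀ xor a_last).
⋀-init∧≡⋀-tail∧ : ∀ {q} (a : Fin (2 + q) → Bool) n → n xor ∑[ i < 2 + q ] a i ≡ (3 + q) · true →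
                   ⋀ (a ∘ inject₁) ∧ n ≡ ⋀ (a ∘ suc) ∧ n
⋀-init∧≡⋀-tail∧ {q} a n parity = begin
  (a zero ∧ ⋀ inner) ∧ n      ≡⟨ split (⋀ inner) refl ⟩
  (⋀ inner ∧ aₗ) ∧ n           ≡⟨ cong (_∧ n) (⋀-init-last (a ∘ suc)) ⟨
  ⋀ (a ∘ suc) ∧ n             ∎
  where
  open ≡-Reasoning
  ∧-parity : ∀ x y m → m xor (x xor y) ≡ true → x ∧ m ≡ y ∧ m
  ∧-parity false false true  _  = refl
  ∧-parity false true  false _  = refl
  ∧-parity true  false false _  = refl
  ∧-parity true  true  true  _  = refl
  ∧-parity false false false ()
  ∧-parity false true  true  ()
  ∧-parity true  false true  ()
  ∧-parity true  true  false ()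
  xor-cancel : ∀ x y c m → m xor (x xor (c xor y)) ≡ (3 · true) xor c → m xor (x xor y) ≡ true
  xor-cancel x y false m odd = odd
  xor-cancel x y true  m odd =
    not-injective (trans (not-distribʳ-xor m (x xor y)) (trans (cong (m xor_) (not-distribʳ-xor x y)) odd))
  inner = λ (i : Fin q) → a (suc (inject₁ i))
  aₗ = a (suc (fromℕ q))
  parity′ : n xor (a zero xor (∑[ i < q ] inner i xor aₗ)) ≡ (3 · true) xor (q · true)
  parity′ = trans (cong (λ t → n xor (a zero xor t)) (sym (sum-init-last (a ∘ suc))))
                  (trans parity (×-homo-+ true 3 q))
  split : ∀ m → ⋀ inner ≡ m → (a zero ∧ m) ∧ n ≡ (m ∧ aₗ) ∧ n
  split false _ = cong (_∧ n) (∧-zeroʳ (a zero))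
  split true  ⋀≡true = trans (cong (_∧ n) (∧-identityʳ (a zero))) (∧-parity (a zero) aₗ n
    (xor-cancel (a zero) aₗ (q · true) n
      (trans (cong (λ t → n xor (a zero xor (t xor aₗ))) (sym (∑-true inner (⋀≡true⇒ inner ⋀≡true)))) parity′)))

-- Positions on ℕ

between : ℕ → ℕ → ℕ → Bool
between lo hi d = does (lo ≤? d) ∧ does (d ≤? hi)

between≡true⇒ : ∀ {lo hi d} → between lo hi d ≡ true → lo ≤ d × d ≤ hi
between≡true⇒ {lo} {hi} {d} inside with ∧≡true⇒ {does (lo ≤? d)} inside
... | lo≤d , d≤hi = does≡true⇒ (lo ≤? d) lo≤d , does≡true⇒ (d ≤? hi) d≤hi

between-true : ∀ {lo hi d} → lo ≤ d → d ≤ hi → between lo hi d ≡ true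
between-true {lo} {hi} {d} lo≤d d≤hi = cong₂ _∧_ (dec-true (lo ≤? d) lo≤d) (dec-true (d ≤? hi) d≤hi)

between-false-below : ∀ {lo hi d} → d < lo → between lo hi d ≡ false
between-false-below {lo} {hi} {d} d<lo = cong (_∧ does (d ≤? hi)) (dec-false (lo ≤? d) (<⇒≱ d<lo))

between-false-above : ∀ {lo hi d} → hi < d → between lo hi d ≡ false
between-false-above {lo} {hi} {d} hi<d = trans (cong (does (lo ≤? d) ∧_) (dec-false (d ≤? hi) (<⇒≱ hi<d))) (∧-zeroʳ _)

between-+ : ∀ m {lo hi d} → between (m + lo) (m + hi) (m + d) ≡ between lo hi d
between-+ m {lo} {hi} {d} = cong₂ _∧_
  (does-⇔ (mk⇔ (+-cancelˡ-≤ m lo d) (+-monoʳ-≤ m)) (m + lo ≤? m + d) (lo ≤? d))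
  (does-⇔ (mk⇔ (+-cancelˡ-≤ m d hi) (+-monoʳ-≤ m)) (m + d ≤? m + hi) (d ≤? hi))

between-below : ∀ lo {hi d} → d ≤ hi → between lo hi d ≡ does (lo ≤? d)
between-below lo {hi} {d} d≤hi = trans (cong (does (lo ≤? d) ∧_) (dec-true (d ≤? hi) d≤hi)) (∧-identityʳ _)

Near : ℕ → ℕ → ℕ → Set
Near p m n = m ≤ n + p × n ≤ m + p

Near-sym : ∀ {p m n} → Near p m n → Near p n m
Near-sym (m≤n+p , n≤m+p) = n≤m+p , m≤n+p

m⊓n≤o⇒m≤o⊎n≤o : ∀ {m n o} → m ⊓ n ≤ o → m ≤ o ⊎ n ≤ o
m⊓n≤o⇒m≤o⊎n≤o {m} {n} {o} m⊓n≤o with ⊓-sel m n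
... | inj₁ m⊓n≡m = inj₁ (subst (_≤ o) m⊓n≡m m⊓n≤o)
... | inj₂ m⊓n≡n = inj₂ (subst (_≤ o) m⊓n≡n m⊓n≤o)

h<t≤2+h⇒ : ∀ {h t} → h < t → t ≤ 2 + h → t ≡ 1 + h ⊎ t ≡ 2 + h
h<t≤2+h⇒ h<t t≤2+h with m≤n⇒m<n∨m≡n t≤2+h
... | inj₁ t<2+h = inj₁ (≤-antisym (≤-pred t<2+h) h<t)
... | inj₂ t≡2+h = inj₂ t≡2+h

argmin : ∀ {n} (f : Fin (suc n) → ℕ) → ∃ λ i → ∀ j → f i ≤ f j
argmin {zero}  f = zero , λ { zero → ≤-refl }
argmin {suc n} f with i , min ← argmin (f ∘ suc) | f zero ≤? f (suc i)
... | yes f₀≤ = zero  , λ { zero → ≤-refl ; (suc j) → ≤-trans f₀≤ (min j) }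
... | no  f₀≰ = suc i , λ { zero → <⇒≤ (≰⇒> f₀≰) ; (suc j) → min j }

argmax : ∀ {n} (f : Fin (suc n) → ℕ) → ∃ λ i → ∀ j → f j ≤ f i
argmax {zero}  f = zero , λ { zero → ≤-refl }
argmax {suc n} f with i , max ← argmax (f ∘ suc) | f (suc i) ≤? f zero
... | yes ≤f₀ = zero  , λ { zero → ≤-refl ; (suc j) → ≤-trans (max j) ≤f₀ }
... | no  ≰f₀ = suc i , λ { zero → <⇒≤ (≰⇒> ≰f₀) ; (suc j) → max j }

module _ {n} {g : Fin n → ℕ} (g-injective : Injective _≡_ _≡_ g) {xs : List ℕ} (g∈xs : ∀ j → g j ∈ₗ xs) where

  private
    position : Fin n → Fin (length xs)
    position j = index (g∈xs j)

    position-injective : Injective _≡_ _≡_ position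
    position-injective {i} {j} eq = g-injective (index-injective (setoid ℕ) (g∈xs i) (g∈xs j) eq)

  injective⇒≤length : n ≤ length xs
  injective⇒≤length = injective⇒≤ position-injective

  injective⇒onto : length xs ≤ n → ∀ {x} → x ∈ₗ xs → ∃ λ j → g j ≡ x
  injective⇒onto length≤n {x} x∈xs with any? (λ j → g j ≟ x)
  ... | yes hit = hit
  ... | no  miss = ⊥-elim (1+n≰n (≤-trans (avoiding x∈xs position-injective missed) length≤n))
    where
    missed : ∀ j → index x∈xs ≢ position j
    missed j eq = miss (j , sym (index-injective (setoid ℕ) x∈xs (g∈xs j) eq))
    avoiding : ∀ {ys} (x∈ys : x ∈ₗ ys) {f : Fin n → Fin (length ys)} → Injective _≡_ _≡_ f →
               (∀ j → index x∈ys ≢ f j) → suc n ≤ length ys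
    avoiding {_ ∷ _} x∈ys f-inj avoid = s≤s (injective⇒≤ (λ eq → f-inj (punchOut-injective (avoid _) (avoid _) eq)))

interval : ℕ → ℕ → List ℕ
interval lo n = applyUpTo (lo +_) n

∈-interval : ∀ {lo n x} → lo ≤ x → x < lo + n → x ∈ₗ interval lo n
∈-interval {lo} {n} {x} lo≤x x<lo+n = subst (_∈ₗ interval lo n) (m+[n∸m]≡n lo≤x)
  (∈-applyUpTo⁺ (lo +_) (subst (x ∸ lo <_) (m+n∸m≡n lo n) (∸-monoˡ-< x<lo+n lo≤x)))

-- Polynomials over GF(2)

module _ {n k : ℕ} where

  infixl 6 _+ᴾ_
  infixl 7 _*ᴾ_

  _+ᴾ_ : Poly n k → Poly n k → Poly n k
  _+ᴾ_ = _++_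

  _*ᴾ_ : Poly n k → Poly n k → Poly n k
  []      *ᴾ Q = []
  (m ∷ P) *ᴾ Q = map (m ++_) Q +ᴾ P *ᴾ Q

  ∑ᴾ : ∀ {r} → (Fin r → Poly n k) → Poly n k
  ∑ᴾ {zero}  F = []
  ∑ᴾ {suc r} F = F zero +ᴾ ∑ᴾ (F ∘ suc)

  ∏ᴾ : ∀ {r} → (Fin r → Poly n k) → Poly n k
  ∏ᴾ {zero}  F = [ [] ]
  ∏ᴾ {suc r} F = F zero *ᴾ ∏ᴾ (F ∘ suc)

  linear : ∀ {r} → (Fin r → Fin n) → (Fin k → Bool) → Poly n k
  linear vs A = ∑ᴾ λ j → ∑ᴾ λ u → if A u then [ [ (vs j , u) ] ] else []

  module _ (y : Fin n → Fin k → Bool) where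

    evalMon-++ : ∀ m m′ → evalMon y (m ++ m′) ≡ evalMon y m ∧ evalMon y m′
    evalMon-++ []             m′ = refl
    evalMon-++ ((v , u) ∷ m) m′ = trans (cong (y v u ∧_) (evalMon-++ m m′)) (sym (∧-assoc (y v u) _ _))

    evalPoly-+ᴾ : ∀ P Q → evalPoly y (P +ᴾ Q) ≡ evalPoly y P xor evalPoly y Q
    evalPoly-+ᴾ []      Q = refl
    evalPoly-+ᴾ (m ∷ P) Q = trans (cong (evalMon y m xor_) (evalPoly-+ᴾ P Q)) (sym (xor-assoc (evalMon y m) _ _))

    evalPoly-map : ∀ m Q → evalPoly y (map (m ++_) Q) ≡ evalMon y m ∧ evalPoly y Q
    evalPoly-map m []       = sym (∧-zeroʳ (evalMon y m))
    evalPoly-map m (m′ ∷ Q) = trans (cong₂ _xor_ (evalMon-++ m m′) (evalPoly-map m Q))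
                                    (sym (∧-distribˡ-xor (evalMon y m) _ _))

    evalPoly-*ᴾ : ∀ P Q → evalPoly y (P *ᴾ Q) ≡ evalPoly y P ∧ evalPoly y Q
    evalPoly-*ᴾ []      Q = refl
    evalPoly-*ᴾ (m ∷ P) Q = begin
      evalPoly y (map (m ++_) Q +ᴾ P *ᴾ Q)
        ≡⟨ evalPoly-+ᴾ (map (m ++_) Q) (P *ᴾ Q) ⟩
      evalPoly y (map (m ++_) Q) xor evalPoly y (P *ᴾ Q)
        ≡⟨ cong₂ _xor_ (evalPoly-map m Q) (evalPoly-*ᴾ P Q) ⟩
      (evalMon y m ∧ evalPoly y Q) xor (evalPoly y P ∧ evalPoly y Q)
        ≡⟨ ∧-distribʳ-xor (evalPoly y Q) (evalMon y m) (evalPoly y P) ⟨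
      (evalMon y m xor evalPoly y P) ∧ evalPoly y Q
        ∎
      where open ≡-Reasoning

    evalPoly-∑ᴾ : ∀ {r} (F : Fin r → Poly n k) → evalPoly y (∑ᴾ F) ≡ ∑[ i < r ] evalPoly y (F i)
    evalPoly-∑ᴾ {zero}  F = refl
    evalPoly-∑ᴾ {suc r} F = trans (evalPoly-+ᴾ (F zero) _) (cong (evalPoly y (F zero) xor_) (evalPoly-∑ᴾ (F ∘ suc)))

    evalPoly-∏ᴾ : ∀ {r} (F : Fin r → Poly n k) → evalPoly y (∏ᴾ F) ≡ ⋀ (λ i → evalPoly y (F i))
    evalPoly-∏ᴾ {zero}  F = refl
    evalPoly-∏ᴾ {suc r} F = trans (evalPoly-*ᴾ (F zero) _) (cong (evalPoly y (F zero) ∧_) (evalPoly-∏ᴾ (F ∘ suc)))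

    evalPoly-linear : ∀ {r} (vs : Fin r → Fin n) A →
                      evalPoly y (linear vs A) ≡ ∑[ j < r ] ∑[ u < k ] (A u ∧ y (vs j) u)
    evalPoly-linear {r} vs A =
      trans (evalPoly-∑ᴾ {r} _) (sum-cong-≗ λ j →
        trans (evalPoly-∑ᴾ {k} _) (sum-cong-≗ λ u → monomial (A u) (vs j) u))
      where
      monomial : ∀ b v u → evalPoly y (if b then [ [ (v , u) ] ] else []) ≡ b ∧ y v u
      monomial true  v u = trans (xor-identityʳ _) (∧-identityʳ (y v u))
      monomial false v u = refl

  DegreeLE-*ᴾ : ∀ {P Q : Poly n k} {d e} → DegreeLE P d → DegreeLE Q e → DegreeLE (P *ᴾ Q) (d + e)
  DegreeLE-*ᴾ {[]}    []           degQ = []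
  DegreeLE-*ᴾ {m ∷ P} (m≤d ∷ degP) degQ = ++⁺ (shifted degQ) (DegreeLE-*ᴾ degP degQ)
    where
    shifted : ∀ {Q e} → DegreeLE Q e → DegreeLE (map (m ++_) Q) (_ + e)
    shifted []                       = []
    shifted {m′ ∷ _} (m′≤e ∷ degQ) = subst (_≤ _) (sym (length-++ m)) (+-mono-≤ m≤d m′≤e) ∷ shifted degQ

  DegreeLE-∑ᴾ : ∀ {r d} (F : Fin r → Poly n k) → (∀ i → DegreeLE (F i) d) → DegreeLE (∑ᴾ F) d
  DegreeLE-∑ᴾ {zero}  F degF = []
  DegreeLE-∑ᴾ {suc r} F degF = ++⁺ (degF zero) (DegreeLE-∑ᴾ (F ∘ suc) (degF ∘ suc))

  DegreeLE-∏ᴾ : ∀ {r} (F : Fin r → Poly n k) → (∀ i → DegreeLE (F i) 1) → DegreeLE (∏ᴾ F) r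
  DegreeLE-∏ᴾ {zero}  F degF = z≤n ∷ []
  DegreeLE-∏ᴾ {suc r} F degF = DegreeLE-*ᴾ (degF zero) (DegreeLE-∏ᴾ (F ∘ suc) (degF ∘ suc))

  DegreeLE-linear : ∀ {r} (vs : Fin r → Fin n) A → DegreeLE (linear vs A) 1
  DegreeLE-linear {r} vs A = DegreeLE-∑ᴾ {r} _ λ j → DegreeLE-∑ᴾ {k} _ λ u → monomial (A u) (vs j , u)
    where
    monomial : ∀ b v → DegreeLE (if b then [ [ v ] ] else []) 1
    monomial true  v = s≤s z≤n ∷ []
    monomial false v = []

  evalPoly-linear-choice : ∀ {r} (y : Fin n → Fin k → Bool) → ChoiceAssignment y →
                           (vs : Fin r → Fin n) (x : Fin r → Fin k) → (∀ j → y (vs j) (x j) ≡ true) →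
                           ∀ A → evalPoly y (linear vs A) ≡ ∑[ j < r ] A (x j)
  evalPoly-linear-choice y choice vs x chosen A =
    trans (evalPoly-linear y vs A) (sum-cong-≗ λ j → trans (∑-single _ (x j) (unchosen j)) (chosen-term j))
    where
    unchosen : ∀ j u → u ≢ x j → A u ∧ y (vs j) u ≡ false
    unchosen j u u≢xj with y (vs j) u in yu
    ... | false = ∧-zeroʳ (A u)
    ... | true  = ⊥-elim (u≢xj (trans (unique u yu) (sym (unique (x j) (chosen j)))))
      where unique = proj₂ (proj₂ (choice (vs j)))
    chosen-term : ∀ j → A (x j) ∧ y (vs j) (x j) ≡ A (x j)
    chosen-term j = trans (cong (A (x j) ∧_) (chosen j)) (∧-identityʳ (A (x j)))

module Cycle (k : ℕ) .{{_ : NonZero k}} where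

  fwd : Fin k → Fin k → ℕ
  fwd a b = (toℕ b + (k ∸ toℕ a)) % k

  fwd<k : ∀ a b → fwd a b < k
  fwd<k a b = m%n<n _ k

  [m%k+n]%k≡[m+n]%k : ∀ m n → (m % k + n) % k ≡ (m + n) % k
  [m%k+n]%k≡[m+n]%k m n = begin
    (m % k + n) % k         ≡⟨ %-distribˡ-+ (m % k) n k ⟩
    (m % k % k + n % k) % k ≡⟨ cong (λ t → (t + n % k) % k) (m%n%n≡m%n m k) ⟩
    (m % k + n % k) % k     ≡⟨ %-distribˡ-+ m n k ⟨
    (m + n) % k             ∎
    where open ≡-Reasoning

  a+[k∸a]≡k : ∀ (a : Fin k) → toℕ a + (k ∸ toℕ a) ≡ k
  a+[k∸a]≡k a = m+[n∸m]≡n (<⇒≤ (toℕ<n a))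

  fwd-via : ∀ {a b r} → (toℕ a + r) % k ≡ toℕ b → fwd a b ≡ r % k
  fwd-via {a} {b} {r} a+r≡b = begin
    (toℕ b + (k ∸ toℕ a)) % k             ≡⟨ cong (λ t → (t + (k ∸ toℕ a)) % k) a+r≡b ⟨
    ((toℕ a + r) % k + (k ∸ toℕ a)) % k   ≡⟨ [m%k+n]%k≡[m+n]%k (toℕ a + r) (k ∸ toℕ a) ⟩
    (toℕ a + r + (k ∸ toℕ a)) % k         ≡⟨ cong (_% k) (+-solve (toℕ a) r (k ∸ toℕ a)) ⟩
    (r + (toℕ a + (k ∸ toℕ a))) % k       ≡⟨ cong (λ t → (r + t) % k) (a+[k∸a]≡k a) ⟩
    (r + k) % k                            ≡⟨ [m+n]%n≡m%n r k ⟩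
    r % k                                  ∎
    where
    open ≡-Reasoning
    +-solve : ∀ x y z → x + y + z ≡ y + (x + z)
    +-solve = solve-∀

  fwd-spec : ∀ a b → (toℕ a + fwd a b) % k ≡ toℕ b
  fwd-spec a b = begin
    (toℕ a + (toℕ b + (k ∸ toℕ a)) % k) % k  ≡⟨ cong (_% k) (+-comm (toℕ a) _) ⟩
    ((toℕ b + (k ∸ toℕ a)) % k + toℕ a) % k  ≡⟨ [m%k+n]%k≡[m+n]%k _ (toℕ a) ⟩
    (toℕ b + (k ∸ toℕ a) + toℕ a) % k        ≡⟨ cong (_% k) (+-assoc (toℕ b) _ _) ⟩
    (toℕ b + ((k ∸ toℕ a) + toℕ a)) % k      ≡⟨ cong (λ t → (toℕ b + t) % k) (m∸n+n≡m (<⇒≤ (toℕ<n a))) ⟩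
    (toℕ b + k) % k                           ≡⟨ [m+n]%n≡m%n (toℕ b) k ⟩
    toℕ b % k                                 ≡⟨ m<n⇒m%n≡m (toℕ<n b) ⟩
    toℕ b                                     ∎
    where open ≡-Reasoning

  fwd-unique : ∀ {a b r} → r < k → (toℕ a + r) % k ≡ toℕ b → fwd a b ≡ r
  fwd-unique r<k a+r≡b = trans (fwd-via a+r≡b) (m<n⇒m%n≡m r<k)

  fwd-self : ∀ a → fwd a a ≡ 0
  fwd-self a = fwd-unique (>-nonZero⁻¹ k) (trans (cong (_% k) (+-identityʳ (toℕ a))) (m<n⇒m%n≡m (toℕ<n a)))

  fwd≡0⇒≡ : ∀ {a b} → fwd a b ≡ 0 → a ≡ b
  fwd≡0⇒≡ {a} {b} fwd≡0 = toℕ-injective (begin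
    toℕ a                  ≡⟨ m<n⇒m%n≡m (toℕ<n a) ⟨
    toℕ a % k              ≡⟨ cong (_% k) (+-identityʳ (toℕ a)) ⟨
    (toℕ a + 0) % k        ≡⟨ cong (λ t → (toℕ a + t) % k) fwd≡0 ⟨
    (toℕ a + fwd a b) % k  ≡⟨ fwd-spec a b ⟩
    toℕ b                  ∎)
    where open ≡-Reasoning

  fwd-+-mod : ∀ a b c → (toℕ a + (fwd a b + fwd b c)) % k ≡ toℕ c
  fwd-+-mod a b c = begin
    (toℕ a + (fwd a b + fwd b c)) % k       ≡⟨ cong (_% k) (+-assoc (toℕ a) _ _) ⟨
    (toℕ a + fwd a b + fwd b c) % k         ≡⟨ [m%k+n]%k≡[m+n]%k (toℕ a + fwd a b) (fwd b c) ⟨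
    ((toℕ a + fwd a b) % k + fwd b c) % k   ≡⟨ cong (λ t → (t + fwd b c) % k) (fwd-spec a b) ⟩
    (toℕ b + fwd b c) % k                   ≡⟨ fwd-spec b c ⟩
    toℕ c                                   ∎
    where open ≡-Reasoning

  fwd-+ : ∀ a b c → fwd a b + fwd b c ≡ fwd a c ⊎ fwd a b + fwd b c ≡ fwd a c + k
  fwd-+ a b c = split (s <? k)
    where
    open ≡-Reasoning
    s = fwd a b + fwd b c
    split : Dec (s < k) → s ≡ fwd a c ⊎ s ≡ fwd a c + k
    split (yes s<k) = inj₁ (sym (fwd-unique {a} s<k (fwd-+-mod a b c)))
    split (no  s≮k) = inj₂ (begin
      s                ≡⟨ m∸n+n≡m k≤s ⟨
      s ∸ k + k        ≡⟨ cong (_+ k) (m<n⇒m%n≡m s∸k<k) ⟨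
      (s ∸ k) % k + k  ≡⟨ cong (_+ k) (m≤n⇒[n∸m]%m≡n%m k≤s) ⟩
      s % k + k        ≡⟨ cong (_+ k) (fwd-via {a} (fwd-+-mod a b c)) ⟨
      fwd a c + k      ∎)
      where
      k≤s = ≮⇒≥ s≮k
      s∸k<k : s ∸ k < k
      s∸k<k = +-cancelʳ-< _ _ k (subst (_< k + k) (sym (m∸n+n≡m k≤s)) (+-mono-< (fwd<k a b) (fwd<k b c)))

  fwd-target : ∀ a {n} → n < k → ∃ λ b → fwd a b ≡ n
  fwd-target a {n} n<k = fromℕ< (m%n<n (toℕ a + n) k) , fwd-unique {a} n<k (sym (toℕ-fromℕ< _))

  fwd-source : ∀ b {n} → n < k → ∃ λ a → fwd a b ≡ n
  fwd-source b {n} n<k = fromℕ< (m%n<n (toℕ b + (k ∸ n)) k) , fwd-unique n<k (begin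
    (toℕ (fromℕ< (m%n<n (toℕ b + (k ∸ n)) k)) + n) % k ≡⟨ cong (λ t → (t + n) % k) (toℕ-fromℕ< _) ⟩
    ((toℕ b + (k ∸ n)) % k + n) % k                    ≡⟨ [m%k+n]%k≡[m+n]%k _ n ⟩
    (toℕ b + (k ∸ n) + n) % k                          ≡⟨ cong (_% k) (+-assoc (toℕ b) _ n) ⟩
    (toℕ b + ((k ∸ n) + n)) % k                        ≡⟨ cong (λ t → (toℕ b + t) % k) (m∸n+n≡m (<⇒≤ n<k)) ⟩
    (toℕ b + k) % k                                    ≡⟨ [m+n]%n≡m%n (toℕ b) k ⟩
    toℕ b % k                                          ≡⟨ m<n⇒m%n≡m (toℕ<n b) ⟩
    toℕ b                                              ∎)
    where open ≡-Reasoning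

  fwd-complement : ∀ {a b} → a ≢ b → fwd a b + fwd b a ≡ k
  fwd-complement {a} {b} a≢b with fwd-+ a b a
  ... | inj₁ sum≡0 = ⊥-elim (a≢b (fwd≡0⇒≡ (m+n≡0⇒m≡0 _ (trans sum≡0 (fwd-self a)))))
  ... | inj₂ sum≡k = trans sum≡k (cong (_+ k) (fwd-self a))

  fwd-≤ : ∀ {a b} → toℕ a ≤ toℕ b → fwd a b ≡ toℕ b ∸ toℕ a
  fwd-≤ {a} {b} a≤b = fwd-unique {a} (≤-<-trans (m∸n≤m (toℕ b) (toℕ a)) (toℕ<n b))
                                 (trans (cong (_% k) (m+[n∸m]≡n a≤b)) (m<n⇒m%n≡m (toℕ<n b)))

  k∸fwd≡fwd : ∀ {a b} → a ≢ b → k ∸ fwd a b ≡ fwd b a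
  k∸fwd≡fwd {a} {b} a≢b = trans (cong (_∸ fwd a b) (sym (fwd-complement a≢b))) (m+n∸m≡n (fwd a b) (fwd b a))

  cycleDistance≡fwd⊓fwd-≤ : ∀ {a b} → a ≢ b → toℕ a ≤ toℕ b →
                            ∣ toℕ a - toℕ b ∣ ⊓ (k ∸ ∣ toℕ a - toℕ b ∣) ≡ fwd a b ⊓ fwd b a
  cycleDistance≡fwd⊓fwd-≤ {a} {b} a≢b a≤b rewrite m≤n⇒∣m-n∣≡n∸m a≤b | sym (fwd-≤ {a} {b} a≤b) =
    cong (fwd a b ⊓_) (k∸fwd≡fwd a≢b)

  cycleDistance≡fwd⊓fwd : ∀ {a b} → a ≢ b →
                          ∣ toℕ a - toℕ b ∣ ⊓ (k ∸ ∣ toℕ a - toℕ b ∣) ≡ fwd a b ⊓ fwd b a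
  cycleDistance≡fwd⊓fwd {a} {b} a≢b with ≤-total (toℕ a) (toℕ b)
  ... | inj₁ a≤b = cycleDistance≡fwd⊓fwd-≤ a≢b a≤b
  ... | inj₂ b≤a rewrite ∣-∣-comm (toℕ a) (toℕ b) =
    trans (cycleDistance≡fwd⊓fwd-≤ (a≢b ∘ sym) b≤a) (⊓-comm (fwd b a) (fwd a b))

  Adj⇔ : ∀ {p a b} → Adj k p a b ⇔ (a ≢ b × (fwd a b ≤ p ⊎ fwd b a ≤ p))
  Adj⇔ {p} = mk⇔
    (λ (a≢b , d≤p) → a≢b , m⊓n≤o⇒m≤o⊎n≤o (subst (_≤ p) (cycleDistance≡fwd⊓fwd a≢b) d≤p))
    (λ (a≢b , fwd≤p) → a≢b , subst (_≤ p) (sym (cycleDistance≡fwd⊓fwd a≢b))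
                                       ([ m≤n⇒m⊓o≤n _ , m≤n⇒o⊓m≤n _ ]′ fwd≤p))

  Adj-sym : ∀ {p u v} → Adj k p u v → Adj k p v u
  Adj-sym {p} {u} {v} (u≢v , close) =
    u≢v ∘ sym , subst (λ d → d ⊓ (k ∸ d) ≤ p) (∣-∣-comm (toℕ u) (toℕ v)) close

  fwd-∸ : ∀ z {u v} → fwd z u ≤ fwd z v → fwd u v ≡ fwd z v ∸ fwd z u
  fwd-∸ z {u} {v} zu≤zv with fwd-+ z u v
  ... | inj₁ sum≡zv = sym (trans (cong (_∸ fwd z u) (sym sum≡zv)) (m+n∸m≡n (fwd z u) (fwd u v)))
  ... | inj₂ sum≡zv+k = ⊥-elim (<-irrefl sum≡zv+k (+-mono-≤-< zu≤zv (fwd<k u v)))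

  fwd-injective : ∀ z {u v} → fwd z u ≡ fwd z v → u ≡ v
  fwd-injective z {u} {v} zu≡zv = fwd≡0⇒≡ (begin
    fwd u v              ≡⟨ fwd-∸ z (≤-reflexive zu≡zv) ⟩
    fwd z v ∸ fwd z u    ≡⟨ cong (_∸ fwd z u) zu≡zv ⟨
    fwd z u ∸ fwd z u    ≡⟨ n∸n≡0 (fwd z u) ⟩
    0                    ∎)
    where open ≡-Reasoning

  fwd-+-< : ∀ z {u v} → fwd z u + fwd u v < k → fwd z u + fwd u v ≡ fwd z v
  fwd-+-< z {u} {v} sum<k with fwd-+ z u v
  ... | inj₁ sum≡zv   = sum≡zv
  ... | inj₂ sum≡zv+k = ⊥-elim (<⇒≱ sum<k (subst (k ≤_) (sym sum≡zv+k) (m≤n+m k _)))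

  fwd≡⇔ : ∀ z {u v d} → fwd z u + d < k → (fwd u v ≡ d ⇔ fwd z v ≡ fwd z u + d)
  fwd≡⇔ z {u} {v} {d} zu+d<k = mk⇔
    (λ uv≡d → trans (sym (fwd-+-< z (subst (λ e → fwd z u + e < k) (sym uv≡d) zu+d<k))) (cong (fwd z u +_) uv≡d))
    (λ zv≡ → trans (fwd-∸ z (subst (fwd z u ≤_) (sym zv≡) (m≤m+n _ d)))
                   (trans (cong (_∸ fwd z u) zv≡) (m+n∸m≡n (fwd z u) d)))

  near⇒Adj : ∀ z {p u v} → u ≢ v → Near p (fwd z u) (fwd z v) → Adj k p u v
  near⇒Adj z {p} {u} {v} u≢v (zu≤zv+p , zv≤zu+p) with ≤-total (fwd z u) (fwd z v)
  ... | inj₁ zu≤zv = from Adj⇔ (u≢v , inj₁ (subst (_≤ p) (sym (fwd-∸ z zu≤zv)) (m≤n+o⇒m∸n≤o _ _ zv≤zu+p)))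
  ... | inj₂ zv≤zu = from Adj⇔ (u≢v , inj₂ (subst (_≤ p) (sym (fwd-∸ z zv≤zu)) (m≤n+o⇒m∸n≤o _ _ zu≤zv+p)))

  Adj⇒near : ∀ z {p u v} → p ≤ fwd z u → fwd z u + p < k → Adj k p u v → Near p (fwd z u) (fwd z v)
  Adj⇒near z {p} {u} {v} p≤zu zu+p<k adj with proj₂ (to Adj⇔ adj)
  ... | inj₁ uv≤p = subst (Near p (fwd z u)) (fwd-+-< z zu+uv<k) (m≤n⇒m≤n+o p (m≤m+n _ _) , +-monoʳ-≤ (fwd z u) uv≤p)
    where zu+uv<k = ≤-<-trans (+-monoʳ-≤ (fwd z u) uv≤p) zu+p<k
  ... | inj₂ vu≤p with fwd-+ z v u
  ...   | inj₁ zv+vu≡zu =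
    subst (λ t → Near p t (fwd z v)) zv+vu≡zu (+-monoʳ-≤ (fwd z v) vu≤p , m≤n⇒m≤n+o p (m≤m+n _ _))
  ...   | inj₂ zv+vu≡zu+k = ⊥-elim (<-irrefl (trans zv+vu≡zu+k (+-comm (fwd z u) k))
                                            (+-mono-<-≤ (fwd<k z v) (≤-trans vu≤p p≤zu)))

module Linear (q : ℕ) where

  p : ℕ
  p = 2 + q

  module _ {r} (g : Fin r → ℕ) where

    occupancy : ℕ → Bool
    occupancy t = ∑[ j < r ] does (g j ≟ t)

    run : ℕ → Bool
    run t = ⋀ λ (i : Fin (suc q)) → occupancy (t + toℕ i)

    trail : ℕ → Bool
    trail t = ∑[ j < r ] between (g j + 2) (g j + (p + 2)) t

    detects : ℕ → Bool
    detects t = run t ∧ trail t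

  module _ {r} (g : Fin r → ℕ) where

    occupancy≡true⇒ : ∀ {t} → occupancy g t ≡ true → ∃ λ j → g j ≡ t
    occupancy≡true⇒ {t} odd with j , hit ← ∑≡true⇒∃ _ odd = j , does≡true⇒ (g j ≟ t) hit

    occupancy-injective : Injective _≡_ _≡_ g → ∀ {j t} → g j ≡ t → occupancy g t ≡ true
    occupancy-injective g-inj {j} {t} gj≡t = trans (∑-single _ j missed) (dec-true (g j ≟ t) gj≡t)
      where
      missed : ∀ i → i ≢ j → does (g i ≟ t) ≡ false
      missed i i≢j = dec-false (g i ≟ t) (λ gi≡t → i≢j (g-inj (trans gi≡t (sym gj≡t))))

    run≡true⇒ : ∀ {t} → run g t ≡ true → ∀ {i} → i ≤ q → ∃ λ j → g j ≡ t + i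
    run≡true⇒ {t} full {i} i≤q
      with j , hit ← occupancy≡true⇒ (⋀≡true⇒ (λ i → occupancy g (t + toℕ i)) full (fromℕ< (s≤s i≤q))) =
      j , trans hit (cong (t +_) (toℕ-fromℕ< (s≤s i≤q)))

    trail≡true⇒ : ∀ {t} → trail g t ≡ true → ∃ λ j → g j + 2 ≤ t × t ≤ g j + (p + 2)
    trail≡true⇒ odd with j , hit ← ∑≡true⇒∃ _ odd = j , between≡true⇒ hit

  ∑-window : ∀ {n} x h → x ≤ h + n → ∑[ i < n ] does (x ≟ suc h + toℕ i) ≡ does (h <? x)
  ∑-window {n} x h x≤h+n with h <? x
  ... | no  h≮x = trans (∑-false {n} _ λ i → dec-false (x ≟ suc h + toℕ i) λ x≡ →
                               h≮x (subst (h <_) (sym x≡) (s≤s (m≤m+n h _))))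
                        (sym (dec-false (h <? x) h≮x))
  ... | yes h<x = trans (∑-single _ i₀ others) (trans (dec-true (x ≟ suc h + toℕ i₀) x≡) (sym (dec-true (h <? x) h<x)))
    where
    offset< : x ∸ suc h < n
    offset< = subst (x ∸ suc h <_) (m+n∸m≡n (suc h) n) (∸-monoˡ-< (s≤s x≤h+n) h<x)
    i₀ = fromℕ< offset<
    x≡ : x ≡ suc h + toℕ i₀
    x≡ = trans (sym (m+[n∸m]≡n h<x)) (cong (suc h +_) (sym (toℕ-fromℕ< offset<)))
    others : ∀ i → i ≢ i₀ → does (x ≟ suc h + toℕ i) ≡ false
    others i i≢i₀ = dec-false (x ≟ suc h + toℕ i) λ x≡′ →
      i≢i₀ (toℕ-injective (+-cancelˡ-≡ (suc h) _ _ (trans (sym x≡′) x≡)))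

  module _ {g : Fin (suc p) → ℕ} {h} (g≢h : ∀ j → g j ≢ h) (near : ∀ j → Near p h (g j)) where

    run-trail-commonNeighbour : ∀ {t} → run g t ≡ true → trail g t ≡ true → t ≡ 1 + h ⊎ t ≡ 2 + h
    run-trail-commonNeighbour {t} full odd with <-cmp h t
    ... | tri< h<t _ _ =
      h<t≤2+h⇒ h<t (+-cancelʳ-≤ q t (2 + h) (subst (t + q ≤_) (trans (sym (+-assoc h 2 q)) (cong (_+ q) (+-comm h 2))) t+q≤h+p))
      where
      t+q≤h+p : t + q ≤ h + p
      t+q≤h+p with j , gj≡t+q ← run≡true⇒ g full (≤-refl {q}) = subst (_≤ h + p) gj≡t+q (proj₂ (near j))
    ... | tri≈ _ h≡t _ with j , gj≡t+0 ← run≡true⇒ g full z≤n =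
      ⊥-elim (g≢h j (trans gj≡t+0 (trans (+-identityʳ t) (sym h≡t))))
    ... | tri> _ _ t<h with h ≤? t + q
    ...   | yes h≤t+q with j , gj≡ ← run≡true⇒ g full (m≤n+o⇒m∸n≤o h t h≤t+q) =
      ⊥-elim (g≢h j (trans gj≡ (m+[n∸m]≡n (<⇒≤ t<h))))
    ...   | no  h≰t+q with j , gj+2≤t , _ ← trail≡true⇒ g odd =
      ⊥-elim (h≰t+q (≤-trans (proj₁ (near j)) (subst (_≤ t + q) (+-assoc (g j) 2 q) (+-monoˡ-≤ q gj+2≤t))))

    detects-commonNeighbour : ∀ {t} → detects g t ≡ true → t ≡ 1 + h ⊎ t ≡ 2 + h
    detects-commonNeighbour {t} detected = uncurry run-trail-commonNeighbour (∧≡true⇒ {run g t} detected)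

    private
      2+h≤ : ∀ j → 2 + h ≤ g j + (p + 2)
      2+h≤ j = subst (2 + h ≤_) (trans (+-comm 2 (g j + p)) (+-assoc (g j) p 2)) (s≤s (s≤s (proj₁ (near j))))

      left-entry : ∀ {t} j → t ≡ 1 + h ⊎ t ≡ 2 + h → between (g j + 2) (g j + (p + 2)) t ≡ does (g j <? h)
      left-entry j (inj₁ refl) = trans (between-below (g j + 2) (≤-trans (n≤1+n _) (2+h≤ j))) (does-⇔ (mk⇔
        (λ gj+2≤1+h → ≤-pred (subst (_≤ 1 + h) (+-comm (g j) 2) gj+2≤1+h))
        (λ gj<h → subst (_≤ 1 + h) (+-comm 2 (g j)) (s≤s gj<h))) (g j + 2 ≤? 1 + h) (g j <? h))
      left-entry j (inj₂ refl) = trans (between-below (g j + 2) (2+h≤ j)) (does-⇔ (mk⇔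
        (λ gj+2≤2+h → ≤∧≢⇒< (≤-pred (≤-pred (subst (_≤ 2 + h) (+-comm (g j) 2) gj+2≤2+h))) (g≢h j))
        (λ gj<h → subst (_≤ 2 + h) (+-comm 2 (g j)) (s≤s (s≤s (<⇒≤ gj<h))))) (g j + 2 ≤? 2 + h) (g j <? h))

      trail≡left : ∀ {t} → t ≡ 1 + h ⊎ t ≡ 2 + h → trail g t ≡ ∑[ j < suc p ] does (g j <? h)
      trail≡left t≡ = sum-cong-≗ λ j → left-entry j t≡

      left⊕right : (∑[ j < suc p ] does (g j <? h)) xor (∑[ j < suc p ] does (h <? g j)) ≡ suc p · true
      left⊕right = trans (sym (∑-distrib-+ (λ j → does (g j <? h)) (λ j → does (h <? g j)))) (∑-true _ exactly-one)
        where
        exactly-one : ∀ j → does (g j <? h) xor does (h <? g j) ≡ true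
        exactly-one j with <-cmp (g j) h
        ... | tri< gj<h _ h≮gj = cong₂ _xor_ (dec-true (g j <? h) gj<h) (dec-false (h <? g j) h≮gj)
        ... | tri≈ _ gj≡h _    = ⊥-elim (g≢h j gj≡h)
        ... | tri> gj≮h _ h<gj = cong₂ _xor_ (dec-false (g j <? h) gj≮h) (dec-true (h <? g j) h<gj)

      right≡∑occupancy : ∑[ j < suc p ] does (h <? g j) ≡ ∑[ i < p ] occupancy g (suc h + toℕ i)
      right≡∑occupancy = trans (sum-cong-≗ λ j → sym (∑-window {p} (g j) h (proj₂ (near j))))
                                 (∑-comm {suc p} {p} λ j i → does (g j ≟ suc h + toℕ i))

    detects-1+h≡detects-2+h : detects g (1 + h) ≡ detects g (2 + h)
    detects-1+h≡detects-2+h = begin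
      run g (1 + h) ∧ trail g (1 + h)  ≡⟨ cong₂ _∧_ run₁ (trail≡left (inj₁ refl)) ⟩
      ⋀ (A ∘ inject₁) ∧ left           ≡⟨ ⋀-init∧≡⋀-tail∧ A left parity ⟩
      ⋀ (A ∘ suc) ∧ left               ≡⟨ cong₂ _∧_ run₂ (trail≡left (inj₂ refl)) ⟨
      run g (2 + h) ∧ trail g (2 + h)  ∎
      where
      open ≡-Reasoning
      A = λ (i : Fin p) → occupancy g (suc h + toℕ i)
      left = ∑[ j < suc p ] does (g j <? h)
      run₁ : run g (1 + h) ≡ ⋀ (A ∘ inject₁)
      run₁ = ⋀-cong {suc q} {λ i → occupancy g (suc h + toℕ i)} λ i →
               cong (λ m → occupancy g (suc h + m)) (sym (toℕ-inject₁ i))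
      run₂ : run g (2 + h) ≡ ⋀ (A ∘ suc)
      run₂ = ⋀-cong {suc q} {λ i → occupancy g (2 + h + toℕ i)} λ i → cong (occupancy g) (sym (+-suc (suc h) (toℕ i)))
      parity : left xor ∑[ i < p ] A i ≡ (3 + q) · true
      parity = trans (cong (left xor_) (sym right≡∑occupancy)) left⊕right

  record Shape (g : Fin (suc p) → ℕ) : Set where
    field
      imin imax : Fin (suc p)
      min≤      : ∀ j → g imin ≤ g j
      ≤max      : ∀ j → g j ≤ g imax
      below     : ∀ j → j ≢ imax → g j ≤ g imin + p
      span      : g imax ≡ g imin + p ⊎ g imax ≡ 2 + (g imin + p)
      covered   : ∀ {i} → i ≤ q → ∃ λ j → g j ≡ g imin + 2 + i

  module _ {g : Fin (suc p) → ℕ} (g-injective : Injective _≡_ _≡_ g) (shape : Shape g) where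

    open Shape shape

    private
      a = g imin
      b = g imax

      above⇒imax : ∀ {j} → a + p < g j → j ≡ imax
      above⇒imax {j} a+p<gj with j Fin.≟ imax
      ... | yes j≡imax = j≡imax
      ... | no  j≢imax = ⊥-elim (<⇒≱ a+p<gj (below j j≢imax))

      trail-max : b ≡ 2 + (a + p) → trail g b ≡ p · true
      trail-max b≡ = trans (sum-remove {i = imax} entry) (cong₂ _xor_ at-max (∑-true _ λ j → inside (punchInᵢ≢i imax j)))
        where
        entry = λ j → between (g j + 2) (g j + (p + 2)) b
        at-max : entry imax ≡ false
        at-max = between-false-below (m<m+n b (s≤s z≤n))
        inside : ∀ {j} → j ≢ imax → entry j ≡ true
        inside {j} j≢imax = between-true
          (subst (g j + 2 ≤_) (trans (+-comm (a + p) 2) (sym b≡)) (+-monoˡ-≤ 2 (below j j≢imax)))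
          (subst (b ≤_) (trans (+-comm 2 (g j + p)) (+-assoc (g j) p 2))
                 (subst (_≤ 2 + (g j + p)) (sym b≡) (s≤s (s≤s (+-monoˡ-≤ p (min≤ j))))))

      -- As a + p + 1 is unoccupied, a run starting after a + 2 must start at b; this forces q = 0,
      -- and then the two entries below b both trail it.
      run-trail-wide : b ≡ 2 + (a + p) → ∀ {t} → run g t ≡ true → trail g t ≡ true → a + 3 ≤ t → ⊥
      run-trail-wide b≡ {t} full odd a+3≤t =
        contradiction (trans (sym (trail-max b≡)) (subst (λ s → trail g s ≡ true) t≡b odd)) p·true≢true
        where
        gap : ¬ t ≤ suc (a + p)
        gap t≤ with j , gj≡ ← run≡true⇒ g full (m≤n+o⇒m∸n≤o (suc (a + p)) t
                                 (subst (_≤ t + q) (trans (+-assoc a 3 q) (+-suc a p)) (+-monoˡ-≤ q a+3≤t))) =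
          <-irrefl (trans (sym gj≡′) (trans (cong g (above⇒imax (≤-reflexive (sym gj≡′)))) b≡)) (n<1+n _)
          where gj≡′ = trans gj≡ (m+[n∸m]≡n t≤)
        t≡b : t ≡ b
        t≡b with j , gj≡ ← run≡true⇒ g full z≤n =
          trans (sym gj≡′) (cong g (above⇒imax (subst (a + p <_) (sym gj≡′) a+p<t)))
          where
          gj≡′ = trans gj≡ (+-identityʳ t)
          a+p<t = <⇒≤ (≰⇒> gap)
        q≡0 : q ≡ 0
        q≡0 with j , gj≡ ← run≡true⇒ g full (≤-refl {q}) =
          n≤0⇒n≡0 (+-cancelˡ-≤ b q 0 (subst₂ _≤_ (trans gj≡ (cong (_+ q) t≡b)) (sym (+-identityʳ b)) (≤max j)))
        p·true≢true : p · true ≢ true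
        p·true≢true = subst (λ m → (2 + m) · true ≢ true) (sym q≡0) (λ ())

      run-trail-shape : ∀ {t} → run g t ≡ true → trail g t ≡ true → t ≡ a + 2
      run-trail-shape {t} full odd = ≤-antisym t≤a+2 a+2≤t
        where
        a+2≤t : a + 2 ≤ t
        a+2≤t with j , gj+2≤t , _ ← trail≡true⇒ g odd = ≤-trans (+-monoˡ-≤ 2 (min≤ j)) gj+2≤t
        t≤a+2 : t ≤ a + 2
        t≤a+2 with span
        ... | inj₁ b≡a+p with j , gj≡ ← run≡true⇒ g full (≤-refl {q}) =
          +-cancelʳ-≤ q t (a + 2) (subst₂ _≤_ gj≡ (trans b≡a+p (sym (+-assoc a 2 q))) (≤max j))
        ... | inj₂ b≡ with t ≤? a + 2
        ...   | yes t≤a+2 = t≤a+2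
        ...   | no  t≰a+2 = ⊥-elim (run-trail-wide b≡ full odd (subst (_≤ t) (sym (+-suc a 2)) (≰⇒> t≰a+2)))

    detects-min+2 : detects g (g imin + 2) ≡ true
    detects-min+2 = cong₂ _∧_ full odd
      where
      full : run g (a + 2) ≡ true
      full = ⋀-true _ λ i → occupancy-injective g g-injective (proj₂ (covered (toℕ≤pred[n] i)))
      odd : trail g (a + 2) ≡ true
      odd = trans (∑-single _ imin others) (between-true ≤-refl (+-monoʳ-≤ a (m≤n+m 2 p)))
        where
        others : ∀ j → j ≢ imin → between (g j + 2) (g j + (p + 2)) (a + 2) ≡ false
        others j j≢imin = between-false-below (+-monoˡ-< 2 (≤∧≢⇒< (min≤ j) (j≢imin ∘ sym ∘ g-injective)))

    detects⇒≡min+2 : ∀ {t} → detects g t ≡ true → t ≡ g imin + 2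
    detects⇒≡min+2 {t} detected = uncurry run-trail-shape (∧≡true⇒ {run g t} detected)

  -- Linear coordinates of a minimal tuple: ω i is a common neighbour of all entries but the i-th,
  -- and is not adjacent to the i-th.
  module _ {g ω : Fin (suc p) → ℕ}
           (apart : ∀ {i j} → j ≢ i → ω i ≢ g j)
           (near  : ∀ {i j} → j ≢ i → Near p (ω i) (g j))
           (far   : ∀ {i} → Near p (ω i) (g i) → ω i ≡ g i) where

    witnesses⇒injective : Injective _≡_ _≡_ g
    witnesses⇒injective {i} {j} gi≡gj with i Fin.≟ j
    ... | yes i≡j = i≡j
    ... | no  i≢j =
      ⊥-elim (apart (i≢j ∘ sym) (trans (far (subst (Near p (ω i)) (sym gi≡gj) (near (i≢j ∘ sym)))) gi≡gj))

    private
      imin = proj₁ (argmin g)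
      imax = proj₁ (argmax g)
      a = g imin
      b = g imax
      min≤ = proj₂ (argmin g)
      ≤max = proj₂ (argmax g)

      inner-fixed : ∀ {j} → j ≢ imin → j ≢ imax → ω j ≡ g j
      inner-fixed {j} j≢imin j≢imax = far
        (≤-trans (proj₁ (near (j≢imin ∘ sym))) (+-monoˡ-≤ p (min≤ j)) ,
         ≤-trans (≤max j) (proj₂ (near (j≢imax ∘ sym))))

      below : ∀ j → j ≢ imax → g j ≤ a + p
      below j j≢imax with j Fin.≟ imin
      ... | yes refl    = m≤m+n a p
      ... | no  j≢imin = subst (_≤ a + p) (inner-fixed j≢imin j≢imax) (proj₁ (near (j≢imin ∘ sym)))

      above : ∀ j → j ≢ imin → b ≤ g j + p
      above j j≢imin with j Fin.≟ imax
      ... | yes refl    = m≤m+n b p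
      ... | no  j≢imax = subst (λ x → b ≤ x + p) (inner-fixed j≢imin j≢imax) (proj₂ (near (j≢imax ∘ sym)))

      extremes∷ : ∀ {xs} → (∀ j → j ≢ imin → j ≢ imax → g j ∈ₗ xs) → ∀ j → g j ∈ₗ a ∷ b ∷ xs
      extremes∷ inner j with j Fin.≟ imin | j Fin.≟ imax
      ... | yes refl | _         = here refl
      ... | no  _    | yes refl  = there (here refl)
      ... | no  j≢imin | no j≢imax = there (there (inner j j≢imin j≢imax))

      a+p≡a+2+q : a + p ≡ a + 2 + q
      a+p≡a+2+q = sym (+-assoc a 2 q)

      ¬narrow : ¬ b < a + p
      ¬narrow b<a+p = 1+n≰n (subst (suc p ≤_) (length-applyUpTo (a +_) p)
        (injective⇒≤length witnesses⇒injective λ j → ∈-interval (min≤ j) (≤-<-trans (≤max j) b<a+p)))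

      ¬wide : ¬ 3 + (a + p) ≤ b
      ¬wide 3+a+p≤b = 1+n≰n (subst (suc p ≤_) (cong (2 +_) (length-applyUpTo (a + 3 +_) q))
        (injective⇒≤length witnesses⇒injective (extremes∷ λ j j≢imin j≢imax → ∈-interval (lo j j≢imin) (hi j j≢imax))))
        where
        lo : ∀ j → j ≢ imin → a + 3 ≤ g j
        lo j j≢imin = +-cancelʳ-≤ p (a + 3) (g j)
          (subst (_≤ g j + p) (trans (sym (+-assoc 3 a p)) (cong (_+ p) (+-comm 3 a))) (≤-trans 3+a+p≤b (above j j≢imin)))
        hi : ∀ j → j ≢ imax → g j < a + 3 + q
        hi j j≢imax = subst (g j <_) (sym (trans (+-assoc a 3 q) (+-suc a p))) (s≤s (below j j≢imax))

      -- The witness for the minimum lies beyond b and the witness for the maximum before a, which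
      -- squeezes the p - 1 inner entries into the p - 2 places a + 2, …, a + p - 1.
      ¬odd-gap : ¬ b ≡ suc (a + p)
      ¬odd-gap b≡ = 1+n≰n (subst (suc p ≤_) (cong (2 +_) (length-applyUpTo (a + 2 +_) q))
        (injective⇒≤length witnesses⇒injective (extremes∷ λ j j≢imin j≢imax → ∈-interval (lo j j≢imin) (hi j j≢imax))))
        where
        imax≢imin : imax ≢ imin
        imax≢imin imax≡imin = <-irrefl (cong g (sym imax≡imin)) (subst (a <_) (sym b≡) (s≤s (m≤m+n a p)))
        ω₀ = ω imin
        ω₁ = ω imax
        a<ω₀ : a < ω₀
        a<ω₀ = +-cancelʳ-≤ p (suc a) ω₀ (subst (_≤ ω₀ + p) b≡ (proj₂ (near imax≢imin)))
        b<ω₀ : b < ω₀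
        b<ω₀ with ω₀ ≤? a + p
        ... | yes ω₀≤a+p = ⊥-elim (<-irrefl (sym (far (ω₀≤a+p , ≤-trans (<⇒≤ a<ω₀) (m≤m+n ω₀ p)))) a<ω₀)
        ... | no  ω₀≰a+p =
          ≤∧≢⇒< (subst (_≤ ω₀) (sym b≡) (≰⇒> ω₀≰a+p)) (λ b≡ω₀ → apart imax≢imin (sym b≡ω₀))
        ω₁≤a+p : ω₁ ≤ a + p
        ω₁≤a+p = proj₁ (near (imax≢imin ∘ sym))
        ω₁<a : ω₁ < a
        ω₁<a with a ≤? ω₁
        ... | no  a≰ω₁ = ≰⇒> a≰ω₁
        ... | yes a≤ω₁ = ⊥-elim (<-irrefl ω₁≡b (subst (ω₁ <_) (sym b≡) (s≤s ω₁≤a+p)))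
          where
          a<ω₁ = ≤∧≢⇒< a≤ω₁ (λ a≡ω₁ → apart (imax≢imin ∘ sym) (sym a≡ω₁))
          ω₁≡b = far (≤-trans ω₁≤a+p (+-monoˡ-≤ p (min≤ imax)) ,
                      subst (_≤ ω₁ + p) (sym b≡) (+-monoˡ-≤ p a<ω₁))
        lo : ∀ j → j ≢ imin → a + 2 ≤ g j
        lo j j≢imin = subst (_≤ g j) (+-comm 2 a)
          (+-cancelʳ-≤ p (2 + a) (g j) (subst (_≤ g j + p) (cong suc b≡) (≤-trans b<ω₀ (proj₁ (near j≢imin)))))
        hi : ∀ j → j ≢ imax → g j < a + 2 + q
        hi j j≢imax = subst (g j <_) a+p≡a+2+q (≤-<-trans (proj₂ (near j≢imax)) (+-monoˡ-< p ω₁<a))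

      span : b ≡ a + p ⊎ b ≡ 2 + (a + p)
      span with <-cmp b (a + p)
      ... | tri< b<a+p _ _ = ⊥-elim (¬narrow b<a+p)
      ... | tri≈ _ b≡a+p _ = inj₁ b≡a+p
      ... | tri> _ _ a+p<b with m≤n⇒m<n∨m≡n a+p<b
      ...   | inj₂ 1+a+p≡b = ⊥-elim (¬odd-gap (sym 1+a+p≡b))
      ...   | inj₁ 1+a+p<b with m≤n⇒m<n∨m≡n 1+a+p<b
      ...     | inj₂ 2+a+p≡b = inj₂ (sym 2+a+p≡b)
      ...     | inj₁ 2+a+p<b = ⊥-elim (¬wide 2+a+p<b)

      covered : ∀ {i} → i ≤ q → ∃ λ j → g j ≡ a + 2 + i
      covered {i} i≤q with span
      ... | inj₁ b≡a+p = injective⇒onto witnesses⇒injective all∈ (≤-reflexive (length-applyUpTo (a +_) (suc p)))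
                           (∈-interval (≤-trans (m≤m+n a 2) (m≤m+n (a + 2) i)) a+2+i<)
        where
        all∈ : ∀ j → g j ∈ₗ interval a (suc p)
        all∈ j = ∈-interval (min≤ j) (subst (g j <_) (sym (+-suc a p)) (s≤s (subst (g j ≤_) b≡a+p (≤max j))))
        a+2+i< : a + 2 + i < a + suc p
        a+2+i< = subst₂ _<_ (sym (+-assoc a 2 i)) (sym (+-suc a p)) (s≤s (+-monoʳ-≤ a (s≤s (s≤s i≤q))))
      ... | inj₂ b≡ = injective⇒onto witnesses⇒injective (extremes∷ inner∈)
                        (≤-reflexive (cong (2 +_) (length-applyUpTo (a + 2 +_) (suc q))))
                        (there (there (∈-interval (m≤m+n _ i) (+-monoʳ-< (a + 2) (s≤s i≤q)))))
        where
        inner∈ : ∀ j → j ≢ imin → j ≢ imax → g j ∈ₗ interval (a + 2) (suc q)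
        inner∈ j j≢imin j≢imax = ∈-interval
          (subst (_≤ g j) (+-comm 2 a) (+-cancelʳ-≤ p (2 + a) (g j) (subst (_≤ g j + p) b≡ (above j j≢imin))))
          (subst (g j <_) (sym (+-suc (a + 2) q)) (s≤s (subst (g j ≤_) a+p≡a+2+q (below j j≢imax))))

    witnesses⇒shape : Shape g
    witnesses⇒shape = record
      { imin = imin ; imax = imax ; min≤ = min≤ ; ≤max = ≤max ; below = below ; span = span ; covered = covered }

module Forbidding (k : ℕ) .{{_ : NonZero k}} (q : ℕ) where

  open Cycle k
  open Linear q

  at : Fin k → ℕ → Fin k → Bool
  at c i u = does (fwd c u ≟ i)

  behind : Fin k → Fin k → Bool
  behind c u = between 2 (p + 2) (fwd u c)

  module _ {r} (x : Fin r → Fin k) where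

    occupancyᶜ : Fin k → ℕ → Bool
    occupancyᶜ c i = ∑[ j < r ] at c i (x j)

    runᶜ : Fin k → Bool
    runᶜ c = ⋀ λ (i : Fin (suc q)) → occupancyᶜ c (toℕ i)

    trailᶜ : Fin k → Bool
    trailᶜ c = ∑[ j < r ] behind c (x j)

    detectsᶜ : Fin k → Bool
    detectsᶜ c = runᶜ c ∧ trailᶜ c

    detections : Bool
    detections = ∑[ c < k ] detectsᶜ c

  module _ {n r} (vs : Fin r → Fin n) where

    runᴾ : Fin k → Poly n k
    runᴾ c = ∏ᴾ λ (i : Fin (suc q)) → linear vs (at c (toℕ i))

    forbidder : Poly n k
    forbidder = ∑ᴾ λ c → runᴾ c *ᴾ linear vs (behind c)

    forbidder-degree : DegreeLE forbidder p
    forbidder-degree = DegreeLE-∑ᴾ {r = k} (λ c → runᴾ c *ᴾ linear vs (behind c)) λ c →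
      subst (DegreeLE (runᴾ c *ᴾ linear vs (behind c))) (+-comm (suc q) 1)
        (DegreeLE-*ᴾ {P = runᴾ c} {d = suc q}
          (DegreeLE-∏ᴾ (λ i → linear vs (at c (toℕ i))) λ i → DegreeLE-linear vs (at c (toℕ i)))
                     (DegreeLE-linear vs (behind c)))

    evalPoly-forbidder : ∀ (y : Fin n → Fin k → Bool) → ChoiceAssignment y →
                         ∀ x → (∀ j → y (vs j) (x j) ≡ true) → evalPoly y forbidder ≡ detections x
    evalPoly-forbidder y choice x chosen =
      trans (evalPoly-∑ᴾ y {k} (λ c → runᴾ c *ᴾ linear vs (behind c))) (sum-cong-≗ λ c →
        trans (evalPoly-*ᴾ y (runᴾ c) (linear vs (behind c))) (cong₂ _∧_
          (trans (evalPoly-∏ᴾ y {suc q} (λ i → linear vs (at c (toℕ i)))) (⋀-cong {suc q} λ i → value (at c (toℕ i))))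
          (value (behind c))))
      where value = evalPoly-linear-choice y choice vs x chosen

  module _ (z : Fin k) {r} {x : Fin r → Fin k} {lo M}
           (window : ∀ j → lo ≤ fwd z (x j) × fwd z (x j) ≤ M)
           (M+q<k : M + q < k) (M+p+2<lo+k : M + (p + 2) < lo + k) where

    private
      g = fwd z ∘ x

      behind≡ : ∀ {c} → lo ≤ fwd z c → ∀ j → behind c (x j) ≡ between (g j + 2) (g j + (p + 2)) (fwd z c)
      behind≡ {c} lo≤zc j with fwd-+ z (x j) c
      ... | inj₁ gj+f≡zc = trans (sym (between-+ (g j))) (cong (between (g j + 2) (g j + (p + 2))) gj+f≡zc)
      ... | inj₂ gj+f≡zc+k = trans (between-false-above p+2<f) (sym (between-false-below zc<gj+2))
        where
        f = fwd (x j) c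
        p+2<f : p + 2 < f
        p+2<f = +-cancelˡ-< M (p + 2) f (<-≤-trans M+p+2<lo+k (≤-trans (+-monoˡ-≤ k lo≤zc)
                  (subst (_≤ M + f) gj+f≡zc+k (+-monoˡ-≤ f (proj₂ (window j))))))
        zc<gj+2 : fwd z c < g j + 2
        zc<gj+2 = <-≤-trans (+-cancelʳ-< k (fwd z c) (g j) (subst (_< g j + k) gj+f≡zc+k (+-monoʳ-< (g j) (fwd<k (x j) c))))
                            (m≤m+n (g j) 2)

    -- If c is no entry of x, both runs fail at their first place; otherwise c lies in the window,
    -- where forward distances are differences of positions.
    detectsᶜ≡detects : ∀ c → detectsᶜ x c ≡ detects g (fwd z c)
    detectsᶜ≡detects c with any? (λ j → x j Fin.≟ c)
    ... | no c∉x = trans (cong (λ b → (b ∧ ⋀ {q} (λ i → occupancyᶜ x c (toℕ (suc i)))) ∧ trailᶜ x c) emptyᶜ)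
                    (sym (cong (λ b → (b ∧ ⋀ {q} (λ i → occupancy g (fwd z c + toℕ (suc i)))) ∧ trail g (fwd z c)) empty))
      where
      emptyᶜ : occupancyᶜ x c 0 ≡ false
      emptyᶜ = ∑-false _ λ j → dec-false (fwd c (x j) ≟ 0) λ cxj≡0 → c∉x (j , sym (fwd≡0⇒≡ cxj≡0))
      empty : occupancy g (fwd z c + 0) ≡ false
      empty = ∑-false _ λ j → dec-false (g j ≟ fwd z c + 0) λ gj≡ →
                c∉x (j , fwd-injective z (trans gj≡ (+-identityʳ _)))
    ... | yes (j₀ , xj₀≡c) = cong₂ _∧_
      (⋀-cong {suc q} λ i → sum-cong-≗ λ j →
        does-⇔ (fwd≡⇔ z (≤-<-trans (+-mono-≤ zc≤M (toℕ≤pred[n] i)) M+q<k))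
               (fwd c (x j) ≟ toℕ i) (g j ≟ fwd z c + toℕ i))
      (sum-cong-≗ (behind≡ lo≤zc))
      where
      lo≤zc : lo ≤ fwd z c
      lo≤zc = subst (λ u → lo ≤ fwd z u) xj₀≡c (proj₁ (window j₀))
      zc≤M : fwd z c ≤ M
      zc≤M = subst (λ u → fwd z u ≤ M) xj₀≡c (proj₂ (window j₀))

  detections-commonNeighbour : 3 * p + 2 < k → ∀ {x : Fin (suc p) → Fin k} {w} → (∀ j → Adj k p w (x j)) →
                               detections x ≡ false
  detections-commonNeighbour bound {x} {w} adj = begin
    detections x                                    ≡⟨ sum-cong-≗ (detectsᶜ≡detects z window 2p+q<k 2p+[p+2]<k) ⟩
    ∑[ c < k ] detects g (fwd z c)                  ≡⟨ ∑-pair _ c₁≢c₂ others ⟩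
    detects g (fwd z c₁) xor detects g (fwd z c₂)  ≡⟨ cong₂ (λ t t′ → detects g t xor detects g t′) zc₁≡ zc₂≡ ⟩
    detects g (1 + p) xor detects g (2 + p)        ≡⟨ cong (_xor detects g (2 + p)) (detects-1+h≡detects-2+h g≢p near) ⟩
    detects g (2 + p) xor detects g (2 + p)        ≡⟨ xor-same (detects g (2 + p)) ⟩
    false                                           ∎
    where
    open ≡-Reasoning
    2p+[p+2]<k : p + p + (p + 2) < k
    2p+[p+2]<k = subst (_< k) (3*p+2≡ p) bound
      where
      3*p+2≡ : ∀ m → 3 * m + 2 ≡ m + m + (m + 2)
      3*p+2≡ = solve-∀
    2p+q<k : p + p + q < k
    2p+q<k = ≤-<-trans (+-monoʳ-≤ (p + p) (≤-trans (n≤1+n q) (≤-trans (n≤1+n _) (m≤m+n p 2)))) 2p+[p+2]<k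
    p+p<k : p + p < k
    p+p<k = ≤-<-trans (m≤m+n (p + p) _) 2p+[p+2]<k
    z = proj₁ (fwd-source w (≤-<-trans (m≤m+n p p) p+p<k))
    zw≡p = proj₂ (fwd-source w (≤-<-trans (m≤m+n p p) p+p<k))
    g = fwd z ∘ x
    near : ∀ j → Near p p (g j)
    near j = subst (λ t → Near p t (g j)) zw≡p
      (Adj⇒near z (≤-reflexive (sym zw≡p)) (subst (λ t → t + p < k) (sym zw≡p) p+p<k) (adj j))
    g≢p : ∀ j → g j ≢ p
    g≢p j gj≡p = proj₁ (adj j) (fwd-injective z (trans zw≡p (sym gj≡p)))
    window : ∀ j → 0 ≤ g j × g j ≤ p + p
    window j = z≤n , proj₂ (near j)
    target : ∀ t → t ≤ 2 + p → ∃ λ c → fwd z c ≡ t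
    target t t≤ =
      fwd-target z (≤-<-trans (≤-trans t≤ (subst (_≤ p + p + (p + 2)) (+-comm p 2) (m≤n+m (p + 2) (p + p)))) 2p+[p+2]<k)
    c₁ = proj₁ (target (1 + p) (n≤1+n _))
    zc₁≡ = proj₂ (target (1 + p) (n≤1+n _))
    c₂ = proj₁ (target (2 + p) ≤-refl)
    zc₂≡ = proj₂ (target (2 + p) ≤-refl)
    c₁≢c₂ : c₁ ≢ c₂
    c₁≢c₂ c₁≡c₂ = <-irrefl (trans (sym zc₁≡) (trans (cong (fwd z) c₁≡c₂) zc₂≡)) ≤-refl
    others : ∀ c → c ≢ c₁ → c ≢ c₂ → detects g (fwd z c) ≡ false
    others c c≢c₁ c≢c₂ = ¬-not λ detected → [ (λ zc≡ → c≢c₁ (fwd-injective z (trans zc≡ (sym zc₁≡))))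
                                           , (λ zc≡ → c≢c₂ (fwd-injective z (trans zc≡ (sym zc₂≡)))) ]′
                                           (detects-commonNeighbour g≢p near detected)

  module _ (bound : 6 * p < k) {L} {S : Fin (suc p) → Fin k} (minimal : MinimalNoCommonNbr k p L S) where

    private
      dropping : ∀ i → HasCommonNbrOn k p L S (∁ ⁅ i ⁆)
      dropping i = proj₂ minimal (∁ ⁅ i ⁆) (i , x∈p⇒x∉∁p (x∈⁅x⁆ i))

      w : Fin (suc p) → Fin k
      w i = proj₁ (dropping i)

      w-adj : ∀ {i j} → j ≢ i → Adj k p (w i) (S j)
      w-adj {i} {j} j≢i = proj₂ (proj₂ (dropping i)) j (x∉p⇒x∈∁p (x≢y⇒x∉⁅y⁆ j≢i))

      w-nonadj : ∀ i → ¬ Adj k p (w i) (S i)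
      w-nonadj i adj = proj₁ minimal (w i , proj₁ (proj₂ (dropping i)) , all)
        where
        all : ∀ j → Adj k p (w i) (S j)
        all j with j Fin.≟ i
        ... | yes refl = adj
        ... | no  j≢i  = w-adj j≢i

      other : (j : Fin (suc p)) → ∃ λ c → c ≢ zero × c ≢ j
      other zero          = suc zero , (λ ()) , (λ ())
      other (suc zero)    = suc (suc zero) , (λ ()) , (λ ())
      other (suc (suc j)) = suc zero , (λ ()) , (λ ())

      5p = p + p + p + p + p

      5p+p<k : 5p + p < k
      5p+p<k = subst (_< k) (6*p≡ p) bound
        where
        6*p≡ : ∀ m → 6 * m ≡ m + m + m + m + m + m
        6*p≡ = solve-∀

      3p<k : p + p + p < k
      3p<k = ≤-<-trans (≤-trans (m≤m+n (p + p + p) p) (≤-trans (m≤m+n (p + p + p + p) p) (m≤m+n 5p p))) 5p+p<k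

      z = proj₁ (fwd-source (S zero) 3p<k)
      zS₀≡ = proj₂ (fwd-source (S zero) 3p<k)
      g = fwd z ∘ S

      window : ∀ j → p ≤ g j × g j ≤ 5p
      window j = +-cancelʳ-≤ p p (g j) (≤-trans 2p≤ω (proj₁ near-Sj)) , ≤-trans (proj₂ near-Sj) (+-monoˡ-≤ p ω≤4p)
        where
        c = proj₁ (other j)
        ω = fwd z (w c)
        near-S₀ : Near p (p + p + p) ω
        near-S₀ = subst (λ t → Near p t ω) zS₀≡ (Adj⇒near z
          (subst (p ≤_) (sym zS₀≡) (≤-trans (m≤m+n p p) (m≤m+n (p + p) p)))
          (subst (λ t → t + p < k) (sym zS₀≡) (≤-<-trans (m≤m+n (p + p + p + p) p) (≤-<-trans (m≤m+n 5p p) 5p+p<k)))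
          (Adj-sym (w-adj (proj₁ (proj₂ (other j)) ∘ sym))))
        2p≤ω : p + p ≤ ω
        2p≤ω = +-cancelʳ-≤ p (p + p) ω (proj₁ near-S₀)
        ω≤4p : ω ≤ p + p + p + p
        ω≤4p = proj₂ near-S₀
        near-Sj : Near p ω (g j)
        near-Sj = Adj⇒near z (≤-trans (m≤m+n p p) 2p≤ω)
                    (≤-<-trans (+-monoˡ-≤ p ω≤4p) (≤-<-trans (m≤m+n 5p p) 5p+p<k))
                    (w-adj (proj₂ (proj₂ (other j)) ∘ sym))

      apart : ∀ {i j} → j ≢ i → fwd z (w i) ≢ g j
      apart j≢i wi≡Sj = proj₁ (w-adj j≢i) (fwd-injective z wi≡Sj)

      near : ∀ {i j} → j ≢ i → Near p (fwd z (w i)) (g j)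
      near {i} {j} j≢i = Near-sym (Adj⇒near z (proj₁ (window j)) (≤-<-trans (+-monoˡ-≤ p (proj₂ (window j))) 5p+p<k)
                                             (Adj-sym (w-adj j≢i)))

      far : ∀ {i} → Near p (fwd z (w i)) (g i) → fwd z (w i) ≡ g i
      far {i} close with fwd z (w i) ≟ g i
      ... | yes wi≡Si = wi≡Si
      ... | no  wi≢Si = ⊥-elim (w-nonadj i (near⇒Adj z (wi≢Si ∘ cong (fwd z)) close))

      shape = witnesses⇒shape apart near far
      g-injective = witnesses⇒injective apart near far
      a = g (Shape.imin shape)

      a+2<k : a + 2 < k
      a+2<k = ≤-<-trans (+-mono-≤ (proj₂ (window (Shape.imin shape))) (m≤m+n 2 q)) 5p+p<k

      c* = proj₁ (fwd-target z a+2<k)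
      zc*≡ = proj₂ (fwd-target z a+2<k)

      5p+q<k : 5p + q < k
      5p+q<k = ≤-<-trans (+-monoʳ-≤ 5p (≤-trans (n≤1+n q) (n≤1+n (suc q)))) 5p+p<k

      5p+[p+2]<p+k : 5p + (p + 2) < p + k
      5p+[p+2]<p+k = subst (_< p + k) (swap p 5p 2) (+-monoʳ-< p (≤-<-trans (+-monoʳ-≤ 5p (m≤m+n 2 q)) 5p+p<k))
        where
        swap : ∀ l m n → l + (m + n) ≡ m + (l + n)
        swap = solve-∀

    detections-minimal : detections S ≡ true
    detections-minimal = begin
      detections S                     ≡⟨ sum-cong-≗ (detectsᶜ≡detects z window 5p+q<k 5p+[p+2]<p+k) ⟩
      ∑[ c < k ] detects g (fwd z c)   ≡⟨ ∑-single _ c* others ⟩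
      detects g (fwd z c*)             ≡⟨ cong (detects g) zc*≡ ⟩
      detects g (a + 2)                ≡⟨ detects-min+2 g-injective shape ⟩
      true                             ∎
      where
      open ≡-Reasoning
      others : ∀ c → c ≢ c* → detects g (fwd z c) ≡ false
      others c c≢c* = ¬-not λ detected →
        c≢c* (fwd-injective z (trans (detects⇒≡min+2 g-injective shape detected) (sym zc*≡)))

lemma29 : (p k : ℕ) → 2 ≤ p → 6 * p < k →
    (Ls : Fin (suc p) → Subset k) → (∀ i → IncomparableSet k p (Ls i)) →
    (L : Subset k) →
    (S : Fin (suc p) → Fin k) → (∀ i → S i ∈ Ls i) →
    MinimalNoCommonNbr k p L S →
    (n : ℕ) (vs : Fin (suc p) → Fin n) → Injective _≡_ _≡_ vs →
    ForbiddableOn k p L S vs p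
lemma29 p@(suc (suc q)) k _ 6p<k _ _ _ S _ minimal _ vs _ =
  forbidder vs , forbidder-degree vs , λ y choice S′ chosen →
    (λ S′≡S → trans (evalPoly-forbidder vs y choice S λ j → subst (λ u → y (vs j) u ≡ true) (S′≡S j) (chosen j))
                    (detections-minimal 6p<k minimal)) ,
    (λ (_ , _ , adj) → trans (evalPoly-forbidder vs y choice S′ chosen) (detections-commonNeighbour 3p+2<k adj))
  where
  open Forbidding k {{>-nonZero (≤-<-trans z≤n 6p<k)}} q
  3p+2<k : 3 * p + 2 < k
  3p+2<k = ≤-<-trans (+-monoʳ-≤ (3 * p) (≤-trans (m≤m+n 2 q) (m≤m+n p _))) (subst (_< k) (*-distribʳ-+ p 3 3) 6p<k)
lemma29 1 _ (s≤s ())
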